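{- Let $m$ be a positive integer, $M=2m-1$, and $x$ an indeterminate. Let $A$ be the $2m\times 2m$ matrix whose rows are indexed by $k=0,1,\dots,M$ and whose row $k$ is $$\left(x^{k},\ k x^{k},\ k^2x^{k},\ \dots,\ k^{m-1}x^{k},\ x^{ -k},\ k x^{ -k},\ \dots,\ k^{m-1}x^{ -k}\right),$$ with the convention $0^0=1$ (so the row $k=0$ is $(1,0,\dots,0,1,0,\dots,0)$). Then $$\det A = G(m+1)^2\,(x^{ -1}-x)^{m^2},$$ where $G(m+1)=\prod_{j=1}^{m-1} j!$.
   Context: $G(m+1)=(m-1)!(m-2)!\cdots 1!$ is the Barnes $G$-function at a positive integer. -}

module Defs where

open import Level using (Level)
open import Algebra.Bundles using (CommutativeRing)
open import Data.Nat as ℕ using (ℕ; zero; suc)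

open import Data.Fin as Fin using (Fin; zero; suc; toℕ; splitAt; punchIn)
open import Data.Sum using (inj₁; inj₂)

-- G(n+1) = ∏_{j=1}^{n-1} j!  (Barnes G-function at a positive integer)
G1 : ℕ → ℕ
G1 zero    = 1
G1 (suc n) = G1 n ℕ.* (n ℕ.!)

module _ {c ℓ : Level} (R : CommutativeRing c ℓ) where
  open CommutativeRing R using (Carrier; _+_; _*_; -_; 0#; 1#)

  pow : Carrier → ℕ → Carrier
  pow a zero    = 1#
  pow a (suc n) = a * pow a n

  fromℕ : ℕ → Carrier
  fromℕ zero    = 0#
  fromℕ (suc n) = 1# + fromℕ n

  sumFin : ∀ n → (Fin n → Carrier) → Carrier
  sumFin zero    f = 0#
  sumFin (suc n) f = f zero + sumFin n (λ i → f (suc i))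

  det : ∀ n → (Fin n → Fin n → Carrier) → Carrier
  det zero    M = 1#
  det (suc n) M =
    sumFin (suc n) (λ j → pow (- 1#) (toℕ j) * M zero j
                          * det n (λ i k → M (suc i) (punchIn j k)))

  -- The 2m × 2m matrix A, rows k = 0..2m-1; xinv plays the role of x⁻¹.
  -- Column c < m : k^c x^k ; column m + c : k^c x^{-k}.
  matA : (m : ℕ) → (x xinv : Carrier) → Fin (m ℕ.+ m) → Fin (m ℕ.+ m) → Carrier
  matA m x xinv k col with splitAt m col
  ... | inj₁ c = pow (fromℕ (toℕ k)) (toℕ c) * pow x (toℕ k)
  ... | inj₂ c = pow (fromℕ (toℕ k)) (toℕ c) * pow xinv (toℕ k)

module Submission where

-- Proof by row operations encoded as difference operators
-- Δ ν f t = f t - ν f (t+1).  When ν ρ = 1, Δ ν ^ e kills t^c ρ^t for c < e.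
-- Applied to the first row, Δ x ^ b ∘ Δ y ^ a (order a+b, fewer than the
-- number of rows) kills every column except t^a x^t, which it turns into a
-- geometric sequence; expanding along the first row removes that column and
-- leaves a matrix of the same shape sampled from t = s+1.  So the x-columns,
-- then the y-columns, are peeled off one at a time with factors
-- a!·(y-x)^b·x^(b+s) and b!·y^s, and the powers of x and y cancel.

open import Level using (Level)
open import Algebra.Bundles using (CommutativeRing)
open import Algebra.Solver.Ring.AlmostCommutativeRing
  using (_-Raw-AlmostCommutative⟶_) renaming (fromCommutativeRing to toAlmostCommutativeRing)
open import Data.Nat as ℕ using (ℕ; zero; suc)
import Data.Nat.Properties as ℕP
open import Data.Integer as ℤ using (ℤ; +_; -[1+_])
import Data.Integer.Properties as ℤP
open import Data.Sign as Sign using (Sign)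
open import Data.Maybe using (Maybe; just; nothing)
open import Data.Fin as Fin using (Fin; zero; suc; toℕ; punchIn; splitAt; _↑ˡ_)
import Data.Fin.Properties as FinP
open import Data.Vec.Functional using () renaming (_∷_ to _◂_)
open import Relation.Nullary using (yes; no)
open import Function using (_∘_)
open import Data.Sum as Sum using (_⊎_; inj₁; inj₂)
open import Data.List using (List; []; _∷_; _++_; replicate; length)
import Data.List.Properties as ListP
import Relation.Binary.PropositionalEquality as P
open P using (_≡_; _≢_)

open import Defs

-- Instantiating the ring solver
-- with integer coefficients lets it decide identities whose verification
-- needs cancellation (a - a = 0), which abstract coefficients cannot.
module IntegerSolver {c ℓ : Level} (R : CommutativeRing c ℓ) where
  open CommutativeRing R hiding (zero)
  open import Relation.Binary.Reasoning.Setoid setoid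
  open import Algebra.Properties.Ring ring using (-‿involutive; -1*x≈-x; -‿+-comm; -0#≈0#)
  open import Algebra.Properties.CommutativeSemigroup *-commutativeSemigroup using (interchange)

  ι : ℕ → Carrier
  ι = fromℕ R

  ι-+ : ∀ m n → ι (m ℕ.+ n) ≈ ι m + ι n
  ι-+ zero    n = sym (+-identityˡ _)
  ι-+ (suc m) n = trans (+-congˡ (ι-+ m n)) (sym (+-assoc _ _ _))

  ι-* : ∀ m n → ι (m ℕ.* n) ≈ ι m * ι n
  ι-* zero    n = sym (zeroˡ _)
  ι-* (suc m) n = begin
    ι (n ℕ.+ m ℕ.* n)      ≈⟨ ι-+ n (m ℕ.* n) ⟩
    ι n + ι (m ℕ.* n)      ≈⟨ +-cong (sym (*-identityˡ _)) (ι-* m n) ⟩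
    1# * ι n + ι m * ι n   ≈⟨ sym (distribʳ _ _ _) ⟩
    (1# + ι m) * ι n       ∎

  embed : ℤ → Carrier
  embed (+ n)      = ι n
  embed -[1+ n ]   = - ι (suc n)

  ⟦_⟧sign : Sign → Carrier
  ⟦ Sign.+ ⟧sign = 1#
  ⟦ Sign.- ⟧sign = - 1#

  embed-◃ : ∀ s n → embed (s ℤ.◃ n) ≈ ⟦ s ⟧sign * ι n
  embed-◃ s        zero    = sym (zeroʳ _)
  embed-◃ Sign.+   (suc n) = sym (*-identityˡ _)
  embed-◃ Sign.-   (suc n) = sym (-1*x≈-x _)

  embed-signAbs : ∀ i → embed i ≈ ⟦ ℤ.sign i ⟧sign * ι ℤ.∣ i ∣
  embed-signAbs (+ n)      = sym (*-identityˡ _)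
  embed-signAbs -[1+ n ]   = embed-◃ Sign.- (suc n)

  ⟦⟧sign-* : ∀ s t → ⟦ s Sign.* t ⟧sign ≈ ⟦ s ⟧sign * ⟦ t ⟧sign
  ⟦⟧sign-* Sign.+ t      = sym (*-identityˡ _)
  ⟦⟧sign-* Sign.- Sign.+ = sym (*-identityʳ _)
  ⟦⟧sign-* Sign.- Sign.- = sym (trans (-1*x≈-x (- 1#)) (-‿involutive 1#))

  embed-* : ∀ i j → embed (i ℤ.* j) ≈ embed i * embed j
  embed-* i j = begin
    embed (i ℤ.* j)
      ≈⟨ embed-◃ (ℤ.sign i Sign.* ℤ.sign j) (ℤ.∣ i ∣ ℕ.* ℤ.∣ j ∣) ⟩
    ⟦ ℤ.sign i Sign.* ℤ.sign j ⟧sign * ι (ℤ.∣ i ∣ ℕ.* ℤ.∣ j ∣)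
      ≈⟨ *-cong (⟦⟧sign-* (ℤ.sign i) (ℤ.sign j)) (ι-* ℤ.∣ i ∣ ℤ.∣ j ∣) ⟩
    (⟦ ℤ.sign i ⟧sign * ⟦ ℤ.sign j ⟧sign) * (ι ℤ.∣ i ∣ * ι ℤ.∣ j ∣)
      ≈⟨ interchange _ _ _ _ ⟩
    (⟦ ℤ.sign i ⟧sign * ι ℤ.∣ i ∣) * (⟦ ℤ.sign j ⟧sign * ι ℤ.∣ j ∣)
      ≈⟨ sym (*-cong (embed-signAbs i) (embed-signAbs j)) ⟩
    embed i * embed j ∎

  embed-⊖ : ∀ m n → embed (m ℤ.⊖ n) ≈ ι m - ι n
  embed-⊖ m       zero    = sym (trans (+-congˡ -0#≈0#) (+-identityʳ _))
  embed-⊖ zero    (suc n) = sym (+-identityˡ _)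
  embed-⊖ (suc m) (suc n) = begin
    embed (suc m ℤ.⊖ suc n)      ≡⟨ P.cong embed (ℤP.[1+m]⊖[1+n]≡m⊖n m n) ⟩
    embed (m ℤ.⊖ n)              ≈⟨ embed-⊖ m n ⟩
    ι m - ι n                    ≈⟨ sym (+-identityˡ _) ⟩
    0# + (ι m - ι n)             ≈⟨ +-congʳ (sym (-‿inverseʳ 1#)) ⟩
    (1# - 1#) + (ι m - ι n)      ≈⟨ +-assoc _ _ _ ⟩
    1# + (- 1# + (ι m - ι n))    ≈⟨ +-congˡ (sym (+-assoc _ _ _)) ⟩
    1# + ((- 1# + ι m) - ι n)    ≈⟨ +-congˡ (+-congʳ (+-comm _ _)) ⟩
    1# + ((ι m - 1#) - ι n)      ≈⟨ +-congˡ (+-assoc _ _ _) ⟩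
    1# + (ι m + (- 1# - ι n))    ≈⟨ sym (+-assoc _ _ _) ⟩
    (1# + ι m) + (- 1# - ι n)    ≈⟨ +-congˡ (-‿+-comm _ _) ⟩
    (1# + ι m) - (1# + ι n)      ∎

  embed-+ : ∀ i j → embed (i ℤ.+ j) ≈ embed i + embed j
  embed-+ (+ m)      (+ n)      = ι-+ m n
  embed-+ (+ m)      -[1+ n ]   = embed-⊖ m (suc n)
  embed-+ -[1+ m ]   (+ n)      = trans (embed-⊖ n (suc m)) (+-comm _ _)
  embed-+ -[1+ m ]   -[1+ n ]   = begin
    - ι (suc (suc (m ℕ.+ n)))        ≡⟨ P.cong (λ k → - ι (suc k)) (P.sym (ℕP.+-suc m n)) ⟩
    - ι (suc m ℕ.+ suc n)            ≈⟨ -‿cong (ι-+ (suc m) (suc n)) ⟩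
    - (ι (suc m) + ι (suc n))        ≈⟨ sym (-‿+-comm _ _) ⟩
    - ι (suc m) - ι (suc n)          ∎

  embed-neg : ∀ i → embed (ℤ.- i) ≈ - embed i
  embed-neg (+ zero)   = sym -0#≈0#
  embed-neg (+ suc n)  = refl
  embed-neg -[1+ n ]   = sym (-‿involutive _)

  -- The same map, normalised so that ±1 are sent to ±1# on the nose: the
  -- solver's constants con (+ 1) and con -[1+ 0 ] then denote 1# and - 1#.
  ι₁ : ℕ → Carrier
  ι₁ zero    = 1#
  ι₁ (suc n) = 1# + ι₁ n

  ⟦_⟧ℤ : ℤ → Carrier
  ⟦ + zero   ⟧ℤ = 0#
  ⟦ + suc n  ⟧ℤ = ι₁ n
  ⟦ -[1+ n ] ⟧ℤ = - ι₁ n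

  ι₁≈ι : ∀ n → ι₁ n ≈ ι (suc n)
  ι₁≈ι zero    = sym (+-identityʳ _)
  ι₁≈ι (suc n) = +-congˡ (ι₁≈ι n)

  ⟦⟧ℤ≈embed : ∀ i → ⟦ i ⟧ℤ ≈ embed i
  ⟦⟧ℤ≈embed (+ zero)  = refl
  ⟦⟧ℤ≈embed (+ suc n) = ι₁≈ι n
  ⟦⟧ℤ≈embed -[1+ n ]  = -‿cong (ι₁≈ι n)

  ⟦⟧ℤ-+ : ∀ i j → ⟦ i ℤ.+ j ⟧ℤ ≈ ⟦ i ⟧ℤ + ⟦ j ⟧ℤ
  ⟦⟧ℤ-+ i j = trans (⟦⟧ℤ≈embed (i ℤ.+ j)) (trans (embed-+ i j) (sym (+-cong (⟦⟧ℤ≈embed i) (⟦⟧ℤ≈embed j))))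

  ⟦⟧ℤ-* : ∀ i j → ⟦ i ℤ.* j ⟧ℤ ≈ ⟦ i ⟧ℤ * ⟦ j ⟧ℤ
  ⟦⟧ℤ-* i j = trans (⟦⟧ℤ≈embed (i ℤ.* j)) (trans (embed-* i j) (sym (*-cong (⟦⟧ℤ≈embed i) (⟦⟧ℤ≈embed j))))

  ⟦⟧ℤ-neg : ∀ i → ⟦ ℤ.- i ⟧ℤ ≈ - ⟦ i ⟧ℤ
  ⟦⟧ℤ-neg i = trans (⟦⟧ℤ≈embed (ℤ.- i)) (trans (embed-neg i) (sym (-‿cong (⟦⟧ℤ≈embed i))))

  ℤ-morphism : CommutativeRing.rawRing ℤP.+-*-commutativeRing
                 -Raw-AlmostCommutative⟶ toAlmostCommutativeRing R
  ℤ-morphism = record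
    { ⟦_⟧ = ⟦_⟧ℤ ; +-homo = ⟦⟧ℤ-+ ; *-homo = ⟦⟧ℤ-* ; -‿homo = ⟦⟧ℤ-neg
    ; 0-homo = refl ; 1-homo = refl }

  coefficient≟ : ∀ i j → Maybe (⟦ i ⟧ℤ ≈ ⟦ j ⟧ℤ)
  coefficient≟ i j with i ℤ.≟ j
  ... | yes P.refl = just refl
  ... | no _       = nothing

  open import Algebra.Solver.Ring _ (toAlmostCommutativeRing R) ℤ-morphism coefficient≟ public
    using (solve; _:+_; _:*_; _:-_; :-_; con; _:=_)

-- Finite sums ∑ n f = f 0 + … + f (n-1), the sumFin of Defs.  It is not
-- definitionally the library's Vector sum, so its standard facts are
-- derived directly.
module FiniteSums {c ℓ : Level} (R : CommutativeRing c ℓ) where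
  open CommutativeRing R hiding (zero)
  open IntegerSolver R
  open import Relation.Binary.Reasoning.Setoid setoid

  ∑ : ∀ n → (Fin n → Carrier) → Carrier
  ∑ = sumFin R

  ∑-cong : ∀ n {f g : Fin n → Carrier} → (∀ i → f i ≈ g i) → ∑ n f ≈ ∑ n g
  ∑-cong zero    f≈g = refl
  ∑-cong (suc n) f≈g = +-cong (f≈g zero) (∑-cong n (f≈g ∘ suc))

  ∑-zero : ∀ n {f : Fin n → Carrier} → (∀ i → f i ≈ 0#) → ∑ n f ≈ 0#
  ∑-zero zero    f≈0 = refl
  ∑-zero (suc n) f≈0 = trans (+-cong (f≈0 zero) (∑-zero n (f≈0 ∘ suc))) (+-identityˡ _)

  ∑-+ : ∀ n (f g : Fin n → Carrier) → ∑ n (λ i → f i + g i) ≈ ∑ n f + ∑ n g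
  ∑-+ zero    f g = sym (+-identityˡ _)
  ∑-+ (suc n) f g = trans (+-congˡ (∑-+ n (f ∘ suc) (g ∘ suc)))
    (solve 4 (λ a b p q → (a :+ b) :+ (p :+ q) := (a :+ p) :+ (b :+ q)) refl _ _ _ _)

  ∑-*ˡ : ∀ n a (f : Fin n → Carrier) → ∑ n (λ i → a * f i) ≈ a * ∑ n f
  ∑-*ˡ zero    a f = sym (zeroʳ _)
  ∑-*ˡ (suc n) a f = trans (+-congˡ (∑-*ˡ n a (f ∘ suc))) (sym (distribˡ _ _ _))

  ∑-*ʳ : ∀ n a (f : Fin n → Carrier) → ∑ n (λ i → f i * a) ≈ ∑ n f * a
  ∑-*ʳ n a f = trans (∑-cong n (λ i → *-comm _ _)) (trans (∑-*ˡ n a f) (*-comm _ _))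

  ∑-swap : ∀ n m (f : Fin n → Fin m → Carrier) →
    ∑ n (λ i → ∑ m (f i)) ≈ ∑ m (λ j → ∑ n (λ i → f i j))
  ∑-swap zero    m f = sym (∑-zero m (λ _ → refl))
  ∑-swap (suc n) m f = begin
    ∑ m (f zero) + ∑ n (λ i → ∑ m (f (suc i)))              ≈⟨ +-congˡ (∑-swap n m (f ∘ suc)) ⟩
    ∑ m (f zero) + ∑ m (λ j → ∑ n (λ i → f (suc i) j))      ≈⟨ sym (∑-+ m _ _) ⟩
    ∑ m (λ j → f zero j + ∑ n (λ i → f (suc i) j))          ∎

  ∑-single : ∀ n (f : Fin n → Carrier) (i₀ : Fin n) → (∀ i → i ≢ i₀ → f i ≈ 0#) → ∑ n f ≈ f i₀
  ∑-single (suc n) f zero     f≈0 =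
    trans (+-congˡ (∑-zero n (λ i → f≈0 (suc i) (λ ())))) (+-identityʳ _)
  ∑-single (suc n) f (suc i₀) f≈0 =
    trans (+-cong (f≈0 zero (λ ()))
                  (∑-single n (f ∘ suc) i₀ (λ i i≢i₀ → f≈0 (suc i) (i≢i₀ ∘ FinP.suc-injective))))
          (+-identityˡ _)

-- The central fact is that it vanishes when the first
-- row repeats another row: for rows 0 and 1 a double expansion cancels in
-- pairs; antisymmetry under swapping rows 0 and 1 follows by polarization;
-- swapping rows 0 and 1 then moves any repeated row into a minor.
module Determinant {c ℓ : Level} (R : CommutativeRing c ℓ) where
  open CommutativeRing R hiding (zero)
  open IntegerSolver R
  open FiniteSums R
  open import Relation.Binary.Reasoning.Setoid setoid

  Row : ℕ → Set c
  Row n = Fin n → Carrier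

  Matrix : ℕ → Set c
  Matrix n = Fin n → Row n

  sign : ∀ {n} → Fin n → Carrier
  sign j = pow R (- 1#) (toℕ j)

  Det : ∀ n → Matrix n → Carrier
  Det = det R

  dropColumn : ∀ {m n} → Fin (suc n) → (Fin m → Row (suc n)) → Fin m → Row n
  dropColumn j N i k = N i (punchIn j k)

  cofactor : ∀ {n} → (Fin n → Row (suc n)) → Fin (suc n) → Carrier
  cofactor N j = sign j * Det _ (dropColumn j N)

  Det-cong : ∀ n {M M′ : Matrix n} → (∀ i j → M i j ≈ M′ i j) → Det n M ≈ Det n M′
  Det-cong zero    M≈M′ = refl
  Det-cong (suc n) M≈M′ = ∑-cong (suc n) (λ j →
    *-cong (*-congˡ {sign j} (M≈M′ zero j)) (Det-cong n (λ i k → M≈M′ (suc i) (punchIn j k))))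

  Det-rows : ∀ n (M : Matrix (suc n)) → Det (suc n) M ≈ Det (suc n) (M zero ◂ (M ∘ suc))
  Det-rows n M = Det-cong (suc n) {M} {M zero ◂ (M ∘ suc)} (λ { zero j → refl ; (suc i) j → refl })

  Det-expansion : ∀ n (u : Row (suc n)) (N : Fin n → Row (suc n)) →
    Det (suc n) (u ◂ N) ≈ ∑ (suc n) (λ j → u j * cofactor N j)
  Det-expansion n u N = ∑-cong (suc n) (λ j →
    solve 3 (λ s a d → s :* a :* d := a :* (s :* d)) refl (sign j) (u j) (Det n (dropColumn j N)))

  Det-additive : ∀ n (u v : Row (suc n)) (N : Fin n → Row (suc n)) →
    Det (suc n) ((λ j → u j + v j) ◂ N) ≈ Det (suc n) (u ◂ N) + Det (suc n) (v ◂ N)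
  Det-additive n u v N = begin
    Det (suc n) ((λ j → u j + v j) ◂ N)
      ≈⟨ Det-expansion n (λ j → u j + v j) N ⟩
    ∑ (suc n) (λ j → (u j + v j) * cofactor N j)
      ≈⟨ ∑-cong (suc n) (λ j → distribʳ (cofactor N j) (u j) (v j)) ⟩
    ∑ (suc n) (λ j → u j * cofactor N j + v j * cofactor N j)
      ≈⟨ ∑-+ (suc n) (λ j → u j * cofactor N j) (λ j → v j * cofactor N j) ⟩
    ∑ (suc n) (λ j → u j * cofactor N j) + ∑ (suc n) (λ j → v j * cofactor N j)
      ≈⟨ sym (+-cong (Det-expansion n u N) (Det-expansion n v N)) ⟩
    Det (suc n) (u ◂ N) + Det (suc n) (v ◂ N) ∎

  Det-linear : ∀ n m (a : Fin m → Carrier) (V : Fin m → Row (suc n)) (N : Fin n → Row (suc n)) →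
    Det (suc n) ((λ j → ∑ m (λ k → a k * V k j)) ◂ N) ≈ ∑ m (λ k → a k * Det (suc n) (V k ◂ N))
  Det-linear n m a V N = begin
    Det (suc n) ((λ j → ∑ m (λ k → a k * V k j)) ◂ N)
      ≈⟨ Det-expansion n (λ j → ∑ m (λ k → a k * V k j)) N ⟩
    ∑ (suc n) (λ j → ∑ m (λ k → a k * V k j) * cofactor N j)
      ≈⟨ ∑-cong (suc n) (λ j → sym (∑-*ʳ m (cofactor N j) (λ k → a k * V k j))) ⟩
    ∑ (suc n) (λ j → ∑ m (λ k → a k * V k j * cofactor N j))
      ≈⟨ ∑-swap (suc n) m (λ j k → a k * V k j * cofactor N j) ⟩
    ∑ m (λ k → ∑ (suc n) (λ j → a k * V k j * cofactor N j))
      ≈⟨ ∑-cong m (λ k → trans (∑-cong (suc n) (λ j → *-assoc (a k) (V k j) (cofactor N j)))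
                                 (∑-*ˡ (suc n) (a k) (λ j → V k j * cofactor N j))) ⟩
    ∑ m (λ k → a k * ∑ (suc n) (λ j → V k j * cofactor N j))
      ≈⟨ ∑-cong m (λ k → *-congˡ (sym (Det-expansion n (V k) N))) ⟩
    ∑ m (λ k → a k * Det (suc n) (V k ◂ N)) ∎

  Extensional : ∀ {n m} → ((Fin n → Fin m) → Carrier) → Set ℓ
  Extensional F = ∀ σ τ → (∀ l → σ l ≡ τ l) → F σ ≈ F τ

  -- The terms of the double expansion of a determinant whose first two rows
  -- both equal r, F giving the determinant of the rows below.
  pairTerm : ∀ {n} → Row (suc (suc n)) → ((Fin n → Fin (suc (suc n))) → Carrier) →
    Fin (suc (suc n)) → Fin (suc n) → Carrier
  pairTerm r F j k = (sign j * sign k) * ((r j * r (punchIn j k)) * F (λ l → punchIn j (punchIn k l)))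

  pairSum : ∀ n → Row (suc (suc n)) → ((Fin n → Fin (suc (suc n))) → Carrier) → Carrier
  pairSum n r F = ∑ (suc (suc n)) (λ j → ∑ (suc n) (pairTerm r F j))

  lift : ∀ {n m} → (Fin n → Fin m) → Fin (suc n) → Fin (suc m)
  lift σ = zero ◂ (suc ∘ σ)

  -- The terms (0, k) and (k+1, 0) cancel; the terms (j+1, k+1) form the
  -- same kind of sum one size smaller.
  mutual
    pairSum-vanishes : ∀ n r F → Extensional F → pairSum n r F ≈ 0#
    pairSum-vanishes n r F F-ext = begin
      ∑ (suc n) (pairTerm r F zero) + ∑ (suc n) (λ j → pairTerm r F (suc j) zero + inner j)
        ≈⟨ +-congˡ (∑-+ (suc n) (λ j → pairTerm r F (suc j) zero) inner) ⟩
      ∑ (suc n) (pairTerm r F zero) + (∑ (suc n) (λ j → pairTerm r F (suc j) zero) + ∑ (suc n) inner)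
        ≈⟨ sym (+-assoc _ _ _) ⟩
      (∑ (suc n) (pairTerm r F zero) + ∑ (suc n) (λ j → pairTerm r F (suc j) zero)) + ∑ (suc n) inner
        ≈⟨ +-congʳ (sym (∑-+ (suc n) (pairTerm r F zero) (λ j → pairTerm r F (suc j) zero))) ⟩
      ∑ (suc n) (λ k → pairTerm r F zero k + pairTerm r F (suc k) zero) + ∑ (suc n) inner
        ≈⟨ +-cong (∑-zero (suc n) cancel) (interior-vanishes n r F F-ext) ⟩
      0# + 0#  ≈⟨ +-identityˡ _ ⟩
      0#       ∎
      where
      inner : Fin (suc n) → Carrier
      inner j = ∑ n (λ k → pairTerm r F (suc j) (suc k))
      cancel : ∀ k → pairTerm r F zero k + pairTerm r F (suc k) zero ≈ 0#
      cancel k = solve 4 (λ s a b f →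
        (con (+ 1) :* s) :* ((a :* b) :* f) :+ ((con -[1+ 0 ] :* s) :* con (+ 1)) :* ((b :* a) :* f) := con (+ 0))
        refl (sign k) (r zero) (r (suc k)) (F (λ l → suc (punchIn k l)))

    interior-vanishes : ∀ n r F → Extensional F →
      ∑ (suc n) (λ j → ∑ n (λ k → pairTerm r F (suc j) (suc k))) ≈ 0#
    interior-vanishes zero    r F F-ext = ∑-zero 1 (λ _ → refl)
    interior-vanishes (suc n) r F F-ext =
      trans (∑-cong (suc (suc n)) (λ j → ∑-cong (suc n) (shift j)))
            (pairSum-vanishes n (r ∘ suc) (F ∘ lift) (λ σ τ σ≗τ → F-ext _ _ (lift-cong σ≗τ)))
      where
      lift-cong : ∀ {σ τ : Fin n → Fin (suc (suc n))} → (∀ l → σ l ≡ τ l) → ∀ l → lift σ l ≡ lift τ l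
      lift-cong σ≗τ zero    = P.refl
      lift-cong σ≗τ (suc l) = P.cong suc (σ≗τ l)
      shift : ∀ j k → pairTerm r F (suc j) (suc k) ≈ pairTerm (r ∘ suc) (F ∘ lift) j k
      shift j k = *-cong
        (solve 2 (λ a b → (con -[1+ 0 ] :* a) :* (con -[1+ 0 ] :* b) := a :* b) refl (sign j) (sign k))
        (*-congˡ (F-ext _ _ (λ { zero → P.refl ; (suc l) → P.refl })))

  Det-repeated-row₀₁ : ∀ n (u : Row (suc (suc n))) (N : Fin n → Row (suc (suc n))) →
    Det (suc (suc n)) (u ◂ u ◂ N) ≈ 0#
  Det-repeated-row₀₁ n u N =
    trans (∑-cong (suc (suc n)) expand) (pairSum-vanishes n u F F-ext)
    where
    F : (Fin n → Fin (suc (suc n))) → Carrier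
    F σ = Det n (λ i l → N i (σ l))
    F-ext : Extensional F
    F-ext σ τ σ≗τ = Det-cong n (λ i l → reflexive (P.cong (N i) (σ≗τ l)))
    expand : ∀ j → sign j * u j * Det (suc n) (dropColumn j (u ◂ N)) ≈ ∑ (suc n) (pairTerm u F j)
    expand j = trans
      (sym (∑-*ˡ (suc n) (sign j * u j) (λ k → sign k * u (punchIn j k) * F (λ l → punchIn j (punchIn k l)))))
      (∑-cong (suc n) (λ k →
        solve 5 (λ s a t b f → (s :* a) :* (t :* b :* f) := (s :* t) :* ((a :* b) :* f))
          refl (sign j) (u j) (sign k) (u (punchIn j k)) (F (λ l → punchIn j (punchIn k l)))))

  dropColumn-◂ : ∀ {m n} (j : Fin (suc n)) (v : Row (suc n)) (N : Fin m → Row (suc n)) →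
    ∀ i k → dropColumn j (v ◂ N) i k ≈ ((v ∘ punchIn j) ◂ dropColumn j N) i k
  dropColumn-◂ j v N zero    k = refl
  dropColumn-◂ j v N (suc i) k = refl

  Det-additive₂ : ∀ n (u v w : Row (suc (suc n))) (N : Fin n → Row (suc (suc n))) →
    Det (suc (suc n)) (u ◂ (λ j → v j + w j) ◂ N)
      ≈ Det (suc (suc n)) (u ◂ v ◂ N) + Det (suc (suc n)) (u ◂ w ◂ N)
  Det-additive₂ n u v w N = begin
    Det (suc (suc n)) (u ◂ (λ j → v j + w j) ◂ N)
      ≈⟨ Det-expansion (suc n) u ((λ j → v j + w j) ◂ N) ⟩
    ∑ (suc (suc n)) (λ j → u j * cofactor ((λ j → v j + w j) ◂ N) j)
      ≈⟨ ∑-cong (suc (suc n)) (λ j → trans (*-congˡ (cofactor-additive j)) (distribˡ (u j) _ _)) ⟩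
    ∑ (suc (suc n)) (λ j → u j * cofactor (v ◂ N) j + u j * cofactor (w ◂ N) j)
      ≈⟨ ∑-+ (suc (suc n)) (λ j → u j * cofactor (v ◂ N) j) (λ j → u j * cofactor (w ◂ N) j) ⟩
    ∑ (suc (suc n)) (λ j → u j * cofactor (v ◂ N) j) + ∑ (suc (suc n)) (λ j → u j * cofactor (w ◂ N) j)
      ≈⟨ sym (+-cong (Det-expansion (suc n) u (v ◂ N)) (Det-expansion (suc n) u (w ◂ N))) ⟩
    Det (suc (suc n)) (u ◂ v ◂ N) + Det (suc (suc n)) (u ◂ w ◂ N) ∎
    where
    minorDet : Row (suc (suc n)) → Fin (suc (suc n)) → Carrier
    minorDet x j = Det (suc n) ((x ∘ punchIn j) ◂ dropColumn j N)
    cofactor-additive : ∀ j → cofactor ((λ j → v j + w j) ◂ N) j ≈ cofactor (v ◂ N) j + cofactor (w ◂ N) j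
    cofactor-additive j = begin
      sign j * Det (suc n) (dropColumn j ((λ j → v j + w j) ◂ N))
        ≈⟨ *-congˡ (Det-cong (suc n) (dropColumn-◂ j (λ j → v j + w j) N)) ⟩
      sign j * Det (suc n) ((λ k → v (punchIn j k) + w (punchIn j k)) ◂ dropColumn j N)
        ≈⟨ *-congˡ (Det-additive n (v ∘ punchIn j) (w ∘ punchIn j) (dropColumn j N)) ⟩
      sign j * (minorDet v j + minorDet w j)
        ≈⟨ distribˡ _ _ _ ⟩
      sign j * minorDet v j + sign j * minorDet w j
        ≈⟨ sym (+-cong (*-congˡ (Det-cong (suc n) (dropColumn-◂ j v N)))
                       (*-congˡ (Det-cong (suc n) (dropColumn-◂ j w N)))) ⟩
      cofactor (v ◂ N) j + cofactor (w ◂ N) j ∎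

  -- Swapping the first two rows negates the determinant: polarize the
  -- alternating, biadditive form (u , v) ↦ Det (u ◂ v ◂ N).
  Det-swap₀₁ : ∀ n (u v : Row (suc (suc n))) (N : Fin n → Row (suc (suc n))) →
    Det (suc (suc n)) (u ◂ v ◂ N) + Det (suc (suc n)) (v ◂ u ◂ N) ≈ 0#
  Det-swap₀₁ n u v N = begin
    B u v + B v u                            ≈⟨ +-cong (sym (+-identityˡ _)) (sym (+-identityʳ _)) ⟩
    (0# + B u v) + (B v u + 0#)              ≈⟨ sym (+-cong (+-congʳ (alternating u)) (+-congˡ (alternating v))) ⟩
    (B u u + B u v) + (B v u + B v v)        ≈⟨ sym (+-cong (Det-additive₂ n u u v N) (Det-additive₂ n v u v N)) ⟩
    B u (u +ᵣ v) + B v (u +ᵣ v)              ≈⟨ sym (Det-additive (suc n) u v ((u +ᵣ v) ◂ N)) ⟩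
    B (u +ᵣ v) (u +ᵣ v)                      ≈⟨ alternating (u +ᵣ v) ⟩
    0#                                       ∎
    where
    _+ᵣ_ : Row (suc (suc n)) → Row (suc (suc n)) → Row (suc (suc n))
    (x +ᵣ y) j = x j + y j
    B : Row (suc (suc n)) → Row (suc (suc n)) → Carrier
    B x y = Det (suc (suc n)) (x ◂ y ◂ N)
    alternating : ∀ x → B x x ≈ 0#
    alternating x = Det-repeated-row₀₁ n x N

  -- Rows 0,1 is
  -- the base case; otherwise swap rows 0 and 1, after which every minor
  -- along the new first row has a repeated first row again.
  Det-repeated-row : ∀ n (M : Matrix (suc n)) (i : Fin n) →
    (∀ j → M zero j ≈ M (suc i) j) → Det (suc n) M ≈ 0#
  Det-repeated-row (suc n) M zero M₀≈M₁ =
    trans (Det-cong (suc (suc n)) {M} {M zero ◂ M zero ◂ (λ i → M (suc (suc i)))}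
                    (λ { zero j → refl ; (suc zero) j → sym (M₀≈M₁ j) ; (suc (suc i)) j → refl }))
          (Det-repeated-row₀₁ n (M zero) (λ i → M (suc (suc i))))
  Det-repeated-row (suc n) M (suc i) M₀≈Mᵢ = begin
    Det (suc (suc n)) M                        ≈⟨ Det-rows (suc n) M ⟩
    Det (suc (suc n)) (M₀ ◂ M₁ ◂ rest)         ≈⟨ sym (+-identityʳ _) ⟩
    Det (suc (suc n)) (M₀ ◂ M₁ ◂ rest) + 0#    ≈⟨ +-congˡ (sym swapped-vanishes) ⟩
    Det (suc (suc n)) (M₀ ◂ M₁ ◂ rest) + Det (suc (suc n)) (M₁ ◂ M₀ ◂ rest)
                                               ≈⟨ Det-swap₀₁ n M₀ M₁ rest ⟩
    0#                                         ∎
    where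
    M₀ M₁ : Row (suc (suc n))
    M₀ = M zero
    M₁ = M (suc zero)
    rest : Fin n → Row (suc (suc n))
    rest i = M (suc (suc i))
    minor-vanishes : ∀ j → cofactor (M₀ ◂ rest) j ≈ 0#
    minor-vanishes j = trans
      (*-congˡ {sign j} (Det-repeated-row n (dropColumn j (M₀ ◂ rest)) i (λ k → M₀≈Mᵢ (punchIn j k))))
      (zeroʳ (sign j))
    swapped-vanishes : Det (suc (suc n)) (M₁ ◂ M₀ ◂ rest) ≈ 0#
    swapped-vanishes = trans (Det-expansion (suc n) M₁ (M₀ ◂ rest)) (∑-zero (suc (suc n)) (λ j →
      trans (*-congˡ {M₁ j} (minor-vanishes j)) (zeroʳ (M₁ j))))

  Det-row-operation : ∀ n (M : Matrix (suc n)) (a : Fin (suc n) → Carrier) → a zero ≈ 1# →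
    Det (suc n) ((λ j → ∑ (suc n) (λ k → a k * M k j)) ◂ (M ∘ suc)) ≈ Det (suc n) M
  Det-row-operation n M a a₀≈1 = begin
    Det (suc n) ((λ j → ∑ (suc n) (λ k → a k * M k j)) ◂ (M ∘ suc))
      ≈⟨ Det-linear n (suc n) a M (M ∘ suc) ⟩
    a zero * Det (suc n) (M zero ◂ (M ∘ suc)) + ∑ n (λ k → a (suc k) * Det (suc n) (M (suc k) ◂ (M ∘ suc)))
      ≈⟨ +-cong (*-congʳ a₀≈1) (∑-zero n (λ k → trans (*-congˡ (repeated k)) (zeroʳ _))) ⟩
    1# * Det (suc n) (M zero ◂ (M ∘ suc)) + 0#
      ≈⟨ trans (+-identityʳ _) (*-identityˡ _) ⟩
    Det (suc n) (M zero ◂ (M ∘ suc))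
      ≈⟨ sym (Det-rows n M) ⟩
    Det (suc n) M ∎
    where
    repeated : ∀ k → Det (suc n) (M (suc k) ◂ (M ∘ suc)) ≈ 0#
    repeated k = Det-repeated-row n (M (suc k) ◂ (M ∘ suc)) k (λ j → refl)

  Det-single-entry : ∀ n (u : Row (suc n)) (N : Fin n → Row (suc n)) (j₀ : Fin (suc n)) →
    (∀ j → j ≢ j₀ → u j ≈ 0#) → Det (suc n) (u ◂ N) ≈ u j₀ * cofactor N j₀
  Det-single-entry n u N j₀ u≈0 = trans (Det-expansion n u N)
    (∑-single (suc n) (λ j → u j * cofactor N j) j₀ (λ j j≢j₀ → trans (*-congʳ (u≈0 j j≢j₀)) (zeroˡ _)))

-- With
-- ν ρ = 1, Δ ν annihilates the geometric sequence ρ^t, so Δ ν ^ e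
-- annihilates t^c ρ^t for c < e and sends t^c ρ^t with c = e to
-- c! (-ν)^c ρ^(c+t); on a geometric sequence with ratio μ it acts as
-- multiplication by 1 - ν μ.
module DifferenceOperators {c ℓ : Level} (R : CommutativeRing c ℓ) where
  open CommutativeRing R hiding (zero)
  open IntegerSolver R
  open FiniteSums R
  open import Relation.Binary.Reasoning.Setoid setoid

  Seq : Set c
  Seq = ℕ → Carrier

  Δ : Carrier → Seq → Seq
  Δ ν f t = f t - ν * f (suc t)

  Δ* : List Carrier → Seq → Seq
  Δ* []       f = f
  Δ* (ν ∷ νs) f = Δ ν (Δ* νs f)

  Δ^ : Carrier → ℕ → Seq → Seq
  Δ^ ν e = Δ* (replicate e ν)

  _≗_ : Seq → Seq → Set ℓ
  f ≗ g = ∀ t → f t ≈ g t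

  Δ-cong : ∀ ν {f g} → f ≗ g → Δ ν f ≗ Δ ν g
  Δ-cong ν f≗g t = +-cong (f≗g t) (-‿cong (*-congˡ (f≗g (suc t))))

  Δ*-cong : ∀ νs {f g} → f ≗ g → Δ* νs f ≗ Δ* νs g
  Δ*-cong []       f≗g = f≗g
  Δ*-cong (ν ∷ νs) f≗g = Δ-cong ν (Δ*-cong νs f≗g)

  Δ*-zero : ∀ νs {f} → f ≗ (λ _ → 0#) → Δ* νs f ≗ (λ _ → 0#)
  Δ*-zero []       f≗0 = f≗0
  Δ*-zero (ν ∷ νs) f≗0 t = trans (Δ-cong ν (Δ*-zero νs f≗0) t)
    (solve 1 (λ v → con (+ 0) :- v :* con (+ 0) := con (+ 0)) refl ν)

  Δ*-++ : ∀ νs μs f → Δ* (νs ++ μs) f ≗ Δ* νs (Δ* μs f)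
  Δ*-++ []       μs f t = refl
  Δ*-++ (ν ∷ νs) μs f   = Δ-cong ν (Δ*-++ νs μs f)

  Δ-comm : ∀ ν μ f → Δ ν (Δ μ f) ≗ Δ μ (Δ ν f)
  Δ-comm ν μ f t = solve 5 (λ v u a b d → (a :- u :* b) :- v :* (b :- u :* d) := (a :- v :* b) :- u :* (b :- v :* d))
    refl ν μ (f t) (f (suc t)) (f (suc (suc t)))

  Δ*-comm-Δ : ∀ νs μ f → Δ* νs (Δ μ f) ≗ Δ μ (Δ* νs f)
  Δ*-comm-Δ []       μ f t = refl
  Δ*-comm-Δ (ν ∷ νs) μ f t = trans (Δ-cong ν (Δ*-comm-Δ νs μ f) t) (Δ-comm ν μ (Δ* νs f) t)

  Δ*-comm : ∀ νs μs f → Δ* νs (Δ* μs f) ≗ Δ* μs (Δ* νs f)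
  Δ*-comm νs []       f t = refl
  Δ*-comm νs (μ ∷ μs) f t = trans (Δ*-comm-Δ νs μ (Δ* μs f) t) (Δ-cong μ (Δ*-comm νs μs f) t)

  -- the coefficients of Δ* νs as a combination of shifts
  coeff : List Carrier → ℕ → Carrier
  coeff []       zero    = 1#
  coeff []       (suc k) = 0#
  coeff (ν ∷ νs) zero    = coeff νs zero
  coeff (ν ∷ νs) (suc k) = coeff νs (suc k) - ν * coeff νs k

  coeff-leading : ∀ νs → coeff νs zero ≈ 1#
  coeff-leading []       = refl
  coeff-leading (ν ∷ νs) = coeff-leading νs

  Δ*-expansion : ∀ νs n → length νs ℕ.< n → ∀ f s →
    Δ* νs f s ≈ ∑ n (λ k → coeff νs (toℕ k) * f (s ℕ.+ toℕ k))
  Δ*-expansion [] (suc n) _ f s = sym (begin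
    1# * f (s ℕ.+ 0) + ∑ n (λ k → 0# * f (s ℕ.+ suc (toℕ k)))
      ≈⟨ +-cong (trans (*-identityˡ _) (reflexive (P.cong f (ℕP.+-identityʳ s)))) (∑-zero n (λ k → zeroˡ _)) ⟩
    f s + 0#  ≈⟨ +-identityʳ _ ⟩
    f s       ∎)
  Δ*-expansion (ν ∷ νs) (suc n) (ℕ.s≤s len<n) f s = begin
    Δ* νs f s - ν * Δ* νs f (suc s)
      ≈⟨ +-cong (Δ*-expansion νs (suc n) (ℕP.m≤n⇒m≤1+n len<n) f s)
                (-‿cong (*-congˡ (Δ*-expansion νs n len<n f (suc s)))) ⟩
    (a₀ + ∑ n later) - ν * ∑ n shifted
      ≈⟨ solve 4 (λ a x v y → (a :+ x) :- v :* y := a :+ (x :+ (:- v) :* y)) refl a₀ (∑ n later) ν (∑ n shifted) ⟩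
    a₀ + (∑ n later + - ν * ∑ n shifted)
      ≈⟨ +-congˡ (+-congˡ (sym (∑-*ˡ n (- ν) shifted))) ⟩
    a₀ + (∑ n later + ∑ n (λ k → - ν * shifted k))
      ≈⟨ +-congˡ (sym (∑-+ n later (λ k → - ν * shifted k))) ⟩
    a₀ + ∑ n (λ k → later k + - ν * shifted k)
      ≈⟨ +-congˡ (∑-cong n (λ k → combine (toℕ k))) ⟩
    ∑ (suc n) (λ k → coeff (ν ∷ νs) (toℕ k) * f (s ℕ.+ toℕ k)) ∎
    where
    a₀ : Carrier
    a₀ = coeff νs 0 * f (s ℕ.+ 0)
    later shifted : Fin n → Carrier
    later k   = coeff νs (suc (toℕ k)) * f (s ℕ.+ suc (toℕ k))
    shifted k = coeff νs (toℕ k) * f (suc s ℕ.+ toℕ k)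
    combine : ∀ k → coeff νs (suc k) * f (s ℕ.+ suc k) + - ν * (coeff νs k * f (suc s ℕ.+ k))
                    ≈ (coeff νs (suc k) - ν * coeff νs k) * f (s ℕ.+ suc k)
    combine k = begin
      coeff νs (suc k) * f (s ℕ.+ suc k) + - ν * (coeff νs k * f (suc s ℕ.+ k))
        ≡⟨ P.cong (λ t → coeff νs (suc k) * f (s ℕ.+ suc k) + - ν * (coeff νs k * f t)) (P.sym (ℕP.+-suc s k)) ⟩
      coeff νs (suc k) * f (s ℕ.+ suc k) + - ν * (coeff νs k * f (s ℕ.+ suc k))
        ≈⟨ solve 4 (λ a b v z → a :* z :+ (:- v) :* (b :* z) := (a :- v :* b) :* z)
             refl (coeff νs (suc k)) (coeff νs k) ν (f (s ℕ.+ suc k)) ⟩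
      (coeff νs (suc k) - ν * coeff νs k) * f (s ℕ.+ suc k) ∎

  Δ^-leibniz : ∀ ν g e t →
    Δ^ ν (suc e) (λ t → ι t * g t) t ≈ ι t * Δ^ ν (suc e) g t - ι (suc e) * ν * Δ^ ν e g (suc t)
  Δ^-leibniz ν g zero t =
    solve 4 (λ n v a b → n :* a :- v :* ((con (+ 1) :+ n) :* b) := n :* (a :- v :* b) :- (con (+ 1) :+ con (+ 0)) :* v :* b)
      refl (ι t) ν (g t) (g (suc t))
  Δ^-leibniz ν g (suc e) t = begin
    Δ^ ν (suc e) tg t - ν * Δ^ ν (suc e) tg (suc t)
      ≈⟨ +-cong (Δ^-leibniz ν g e t) (-‿cong (*-congˡ (Δ^-leibniz ν g e (suc t)))) ⟩
    (ι t * a - ι (suc e) * ν * b) - ν * ((1# + ι t) * (b - ν * d) - ι (suc e) * ν * d)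
      ≈⟨ solve 6 (λ n m v a b d → (n :* a :- m :* v :* b) :- v :* ((con (+ 1) :+ n) :* (b :- v :* d) :- m :* v :* d)
                               := n :* (a :- v :* (b :- v :* d)) :- (con (+ 1) :+ m) :* v :* (b :- v :* d))
           refl (ι t) (ι (suc e)) ν a b d ⟩
    ι t * (a - ν * (b - ν * d)) - (1# + ι (suc e)) * ν * (b - ν * d) ∎
    where
    tg : Seq
    tg t = ι t * g t
    a b d : Carrier
    a = Δ^ ν (suc e) g t
    b = Δ^ ν e g (suc t)
    d = Δ^ ν e g (suc (suc t))

  polyExp : Carrier → ℕ → Seq
  polyExp ρ c t = pow R (ι t) c * pow R ρ t

  polyExp-suc : ∀ ρ c t → polyExp ρ (suc c) t ≈ ι t * polyExp ρ c t
  polyExp-suc ρ c t = *-assoc _ _ _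

  module _ (ν ρ : Carrier) (νρ≈1 : ν * ρ ≈ 1#) where

    Δ-kills-geometric : Δ ν (polyExp ρ 0) ≗ (λ _ → 0#)
    Δ-kills-geometric t = begin
      1# * pow R ρ t - ν * (1# * (ρ * pow R ρ t))
        ≈⟨ solve 3 (λ v r p → con (+ 1) :* p :- v :* (con (+ 1) :* (r :* p)) := p :- (v :* r) :* p)
             refl ν ρ (pow R ρ t) ⟩
      pow R ρ t - (ν * ρ) * pow R ρ t
        ≈⟨ +-congˡ (-‿cong (*-congʳ νρ≈1)) ⟩
      pow R ρ t - 1# * pow R ρ t
        ≈⟨ solve 1 (λ p → p :- con (+ 1) :* p := con (+ 0)) refl (pow R ρ t) ⟩
      0# ∎

    Δ^-annihilates : ∀ c e → c ℕ.< e → Δ^ ν e (polyExp ρ c) ≗ (λ _ → 0#)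
    Δ^-annihilates zero (suc e) _ t =
      trans (sym (Δ*-comm-Δ (replicate e ν) ν (polyExp ρ 0) t)) (Δ*-zero (replicate e ν) Δ-kills-geometric t)
    Δ^-annihilates (suc c) (suc e) (ℕ.s≤s c<e) t = begin
      Δ^ ν (suc e) (polyExp ρ (suc c)) t
        ≈⟨ Δ*-cong (replicate (suc e) ν) (polyExp-suc ρ c) t ⟩
      Δ^ ν (suc e) (λ t → ι t * polyExp ρ c t) t
        ≈⟨ Δ^-leibniz ν (polyExp ρ c) e t ⟩
      ι t * Δ^ ν (suc e) (polyExp ρ c) t - ι (suc e) * ν * Δ^ ν e (polyExp ρ c) (suc t)
        ≈⟨ +-cong (*-congˡ (Δ^-annihilates c (suc e) (ℕP.m≤n⇒m≤1+n c<e) t))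
                  (-‿cong (*-congˡ (Δ^-annihilates c e c<e (suc t)))) ⟩
      ι t * 0# - ι (suc e) * ν * 0#
        ≈⟨ solve 3 (λ a b v → a :* con (+ 0) :- b :* v :* con (+ 0) := con (+ 0)) refl (ι t) (ι (suc e)) ν ⟩
      0# ∎

    Δ^-diagonal : ∀ c t → Δ^ ν c (polyExp ρ c) t ≈ ι (c ℕ.!) * pow R (- ν) c * pow R ρ (c ℕ.+ t)
    Δ^-diagonal zero t =
      solve 1 (λ p → con (+ 1) :* p := (con (+ 1) :+ con (+ 0)) :* con (+ 1) :* p) refl (pow R ρ t)
    Δ^-diagonal (suc c) t = begin
      Δ^ ν (suc c) (polyExp ρ (suc c)) t
        ≈⟨ Δ*-cong (replicate (suc c) ν) (polyExp-suc ρ c) t ⟩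
      Δ^ ν (suc c) (λ t → ι t * polyExp ρ c t) t
        ≈⟨ Δ^-leibniz ν (polyExp ρ c) c t ⟩
      ι t * Δ^ ν (suc c) (polyExp ρ c) t - ι (suc c) * ν * Δ^ ν c (polyExp ρ c) (suc t)
        ≈⟨ +-cong (*-congˡ (Δ^-annihilates c (suc c) ℕP.≤-refl t)) (-‿cong (*-congˡ (Δ^-diagonal c (suc t)))) ⟩
      ι t * 0# - ι (suc c) * ν * (ι (c ℕ.!) * pow R (- ν) c * pow R ρ (c ℕ.+ suc t))
        ≡⟨ P.cong (λ k → ι t * 0# - ι (suc c) * ν * (ι (c ℕ.!) * pow R (- ν) c * pow R ρ k)) (ℕP.+-suc c t) ⟩
      ι t * 0# - ι (suc c) * ν * (ι (c ℕ.!) * pow R (- ν) c * (ρ * pow R ρ (c ℕ.+ t)))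
        ≈⟨ solve 6 (λ n m v f p q → n :* con (+ 0) :- m :* v :* (f :* p :* q) := (m :* f) :* ((:- v) :* p) :* q)
             refl (ι t) (ι (suc c)) ν (ι (c ℕ.!)) (pow R (- ν) c) (ρ * pow R ρ (c ℕ.+ t)) ⟩
      (ι (suc c) * ι (c ℕ.!)) * pow R (- ν) (suc c) * pow R ρ (suc c ℕ.+ t)
        ≈⟨ *-congʳ (*-congʳ (sym (ι-* (suc c) (c ℕ.!)))) ⟩
      ι (suc c ℕ.!) * pow R (- ν) (suc c) * pow R ρ (suc c ℕ.+ t) ∎

  Δ^-geometric : ∀ ν μ (h : Seq) → (∀ t → h (suc t) ≈ μ * h t) →
    ∀ e t → Δ^ ν e h t ≈ pow R (1# - ν * μ) e * h t
  Δ^-geometric ν μ h h-ratio zero    t = sym (*-identityˡ _)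
  Δ^-geometric ν μ h h-ratio (suc e) t = begin
    Δ^ ν e h t - ν * Δ^ ν e h (suc t)
      ≈⟨ +-cong (Δ^-geometric ν μ h h-ratio e t)
                (-‿cong (*-congˡ (trans (Δ^-geometric ν μ h h-ratio e (suc t)) (*-congˡ (h-ratio t))))) ⟩
    q * h t - ν * (q * (μ * h t))
      ≈⟨ solve 4 (λ q h v m → q :* h :- v :* (q :* (m :* h)) := (con (+ 1) :- v :* m) :* q :* h) refl q (h t) ν μ ⟩
    (1# - ν * μ) * q * h t ∎
    where
    q : Carrier
    q = pow R (1# - ν * μ) e

-- Matrices whose column j lists consecutive values cols j s, cols j (s+1), …
-- A composite difference operator of order ≤ n, applied to the columns, is
-- a row operation on the first row; if it kills every column but j₀, the
-- determinant reduces to a matrix of the same kind one size smaller.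
module SequenceMatrices {c ℓ : Level} (R : CommutativeRing c ℓ) where
  open CommutativeRing R hiding (zero)
  open FiniteSums R
  open Determinant R
  open DifferenceOperators R
  open import Relation.Binary.Reasoning.Setoid setoid

  seqMatrix : ∀ {n} → (Fin n → Seq) → ℕ → Matrix n
  seqMatrix cols s k j = cols j (s ℕ.+ toℕ k)

  seqMatrix-reduction : ∀ n (cols : Fin (suc n) → Seq) (νs : List Carrier) s → length νs ℕ.< suc n →
    (j₀ : Fin (suc n)) → (∀ j → j ≢ j₀ → Δ* νs (cols j) s ≈ 0#) →
    Det (suc n) (seqMatrix cols s)
      ≈ sign j₀ * Δ* νs (cols j₀) s * Det n (seqMatrix (cols ∘ punchIn j₀) (suc s))
  seqMatrix-reduction n cols νs s order j₀ others-vanish = begin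
    Det (suc n) M
      ≈⟨ sym (Det-row-operation n M (λ k → coeff νs (toℕ k)) (coeff-leading νs)) ⟩
    Det (suc n) ((λ j → ∑ (suc n) (λ k → coeff νs (toℕ k) * M k j)) ◂ (M ∘ suc))
      ≈⟨ Det-cong (suc n) {_ ◂ (M ∘ suc)} {u ◂ (M ∘ suc)}
           (λ { zero j → sym (Δ*-expansion νs (suc n) order (cols j) s) ; (suc i) j → refl }) ⟩
    Det (suc n) (u ◂ (M ∘ suc))
      ≈⟨ Det-single-entry n u (M ∘ suc) j₀ others-vanish ⟩
    u j₀ * (sign j₀ * Det n (dropColumn j₀ (M ∘ suc)))
      ≈⟨ *-congˡ (*-congˡ (Det-cong n (λ i k → reflexive (P.cong (cols (punchIn j₀ k)) (ℕP.+-suc s (toℕ i)))))) ⟩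
    u j₀ * (sign j₀ * Det n (seqMatrix (cols ∘ punchIn j₀) (suc s)))
      ≈⟨ sym (*-assoc _ _ _) ⟩
    u j₀ * sign j₀ * Det n (seqMatrix (cols ∘ punchIn j₀) (suc s))
      ≈⟨ *-congʳ (*-comm _ _) ⟩
    sign j₀ * u j₀ * Det n (seqMatrix (cols ∘ punchIn j₀) (suc s)) ∎
    where
    M : Matrix (suc n)
    M = seqMatrix cols s
    u : Row (suc n)
    u j = Δ* νs (cols j) s

module Powers {c ℓ : Level} (R : CommutativeRing c ℓ) where
  open CommutativeRing R hiding (zero)
  open import Algebra.Properties.CommutativeSemigroup *-commutativeSemigroup using (interchange)

  pow-cong : ∀ {a b} n → a ≈ b → pow R a n ≈ pow R b n
  pow-cong zero    a≈b = refl
  pow-cong (suc n) a≈b = *-cong a≈b (pow-cong n a≈b)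

  pow-+ : ∀ a m n → pow R a (m ℕ.+ n) ≈ pow R a m * pow R a n
  pow-+ a zero    n = sym (*-identityˡ _)
  pow-+ a (suc m) n = trans (*-congˡ (pow-+ a m n)) (sym (*-assoc _ _ _))

  pow-* : ∀ a b n → pow R (a * b) n ≈ pow R a n * pow R b n
  pow-* a b zero    = sym (*-identityˡ _)
  pow-* a b (suc n) = trans (*-congˡ (pow-* a b n)) (interchange a b _ _)

  pow-1 : ∀ n → pow R 1# n ≈ 1#
  pow-1 zero    = refl
  pow-1 (suc n) = trans (*-identityˡ _) (pow-1 n)

  pow-unit : ∀ p q r n → p * q * r ≈ 1# → pow R p n * pow R q n * pow R r n ≈ 1#
  pow-unit p q r n pqr≈1 = begin
    pow R p n * pow R q n * pow R r n  ≈⟨ sym (*-congʳ (pow-* p q n)) ⟩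
    pow R (p * q) n * pow R r n        ≈⟨ sym (pow-* (p * q) r n) ⟩
    pow R (p * q * r) n                ≈⟨ pow-cong n pqr≈1 ⟩
    pow R 1# n                         ≈⟨ pow-1 n ⟩
    1#                                 ∎
    where open import Relation.Binary.Reasoning.Setoid setoid

-- The matrix of the theorem, generalised: for x y = 1, column kind inj₁ c
-- is t ↦ t^c x^t and inj₂ d is t ↦ t^d y^t; the block matrix has a
-- x-columns of degrees 0..a-1, then b y-columns of degrees 0..b-1, sampled
-- at rows t = s, s+1, ….  Removing the top x-column with Δ x ^ b ∘ Δ y ^ a,
-- then the top y-column with Δ x ^ b, peels off one factor at a time.
module ConfluentBlocks {c ℓ : Level} (R : CommutativeRing c ℓ) where
  open CommutativeRing R hiding (zero)
  open IntegerSolver R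
  open Determinant R
  open DifferenceOperators R
  open SequenceMatrices R
  open Powers R
  open import Relation.Binary.Reasoning.Setoid setoid

  columnKind : ∀ a {b} → Fin (a ℕ.+ b) → ℕ ⊎ ℕ
  columnKind a j = Sum.map toℕ toℕ (splitAt a j)

  -- deleting the x-column of degree a from a+1 x-columns and b y-columns
  columnKind-punchIn : ∀ a b (k : Fin (a ℕ.+ b)) →
    columnKind (suc a) (punchIn (Fin.fromℕ a ↑ˡ b) k) ≡ columnKind a k
  columnKind-punchIn zero    b k       = P.refl
  columnKind-punchIn (suc a) b zero    = P.refl
  columnKind-punchIn (suc a) b (suc k) = P.trans (shift (splitAt (suc a) (punchIn (Fin.fromℕ a ↑ˡ b) k)))
    (P.trans (P.cong (Sum.map₁ suc) (columnKind-punchIn a b k)) (P.sym (shift (splitAt a k))))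
    where
    shift : ∀ {m n} (z : Fin m ⊎ Fin n) → Sum.map toℕ toℕ (Sum.map₁ suc z) ≡ Sum.map₁ suc (Sum.map toℕ toℕ z)
    shift (inj₁ _) = P.refl
    shift (inj₂ _) = P.refl

  toℕ-punchIn-last : ∀ b (k : Fin b) → toℕ (punchIn (Fin.fromℕ b) k) ≡ toℕ k
  toℕ-punchIn-last (suc b) zero    = P.refl
  toℕ-punchIn-last (suc b) (suc k) = P.cong suc (toℕ-punchIn-last b k)

  toℕ<-≢last : ∀ {n} (j : Fin (suc n)) → j ≢ Fin.fromℕ n → toℕ j ℕ.< n
  toℕ<-≢last {n} j j≢last = ℕP.≤∧≢⇒< (ℕ.s≤s⁻¹ (FinP.toℕ<n j))
    (λ j≡n → j≢last (FinP.toℕ-injective (P.trans j≡n (P.sym (FinP.toℕ-fromℕ n)))))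

  order-≤ : (νs : List Carrier) (n : ℕ) → length νs ≡ n → length νs ℕ.< suc n
  order-≤ νs n len≡n = ℕ.s≤s (ℕP.≤-reflexive len≡n)

  module _ (x y : Carrier) (xy≈1 : x * y ≈ 1#) where

    yx≈1 : y * x ≈ 1#
    yx≈1 = trans (*-comm y x) xy≈1

    column : ℕ ⊎ ℕ → Seq
    column (inj₁ c) = polyExp x c
    column (inj₂ d) = polyExp y d

    blockMatrix : ∀ a b → ℕ → Matrix (a ℕ.+ b)
    blockMatrix a b = seqMatrix (column ∘ columnKind a)

    yBlock-step : ∀ b s →
      Det (suc b) (blockMatrix 0 (suc b) s) ≈ ι (b ℕ.!) * pow R y s * Det b (blockMatrix 0 b (suc s))
    yBlock-step b s = begin
      Det (suc b) (blockMatrix 0 (suc b) s)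
        ≈⟨ seqMatrix-reduction b cols (replicate b x) s (order-≤ (replicate b x) b (ListP.length-replicate b))
             (Fin.fromℕ b) others-vanish ⟩
      sign (Fin.fromℕ b) * Δ^ x b (cols (Fin.fromℕ b)) s * minor
        ≡⟨ P.cong (λ n → pow R (- 1#) n * Δ^ x b (polyExp y n) s * minor) (FinP.toℕ-fromℕ b) ⟩
      pow R (- 1#) b * Δ^ x b (polyExp y b) s * minor
        ≈⟨ *-cong leading-entry (Det-cong b (λ i k →
             reflexive (P.cong (λ d → polyExp y d (suc s ℕ.+ toℕ i)) (toℕ-punchIn-last b k)))) ⟩
      ι (b ℕ.!) * pow R y s * Det b (blockMatrix 0 b (suc s)) ∎
      where
      cols : Fin (suc b) → Seq
      cols j = polyExp y (toℕ j)
      minor : Carrier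
      minor = Det b (seqMatrix (cols ∘ punchIn (Fin.fromℕ b)) (suc s))
      others-vanish : ∀ j → j ≢ Fin.fromℕ b → Δ^ x b (cols j) s ≈ 0#
      others-vanish j j≢last = Δ^-annihilates x y xy≈1 (toℕ j) b (toℕ<-≢last j j≢last) s
      leading-entry : pow R (- 1#) b * Δ^ x b (polyExp y b) s ≈ ι (b ℕ.!) * pow R y s
      leading-entry = begin
        pow R (- 1#) b * Δ^ x b (polyExp y b) s
          ≈⟨ *-congˡ (trans (Δ^-diagonal x y xy≈1 b s) (*-congˡ (pow-+ y b s))) ⟩
        pow R (- 1#) b * (ι (b ℕ.!) * pow R (- x) b * (pow R y b * pow R y s))
          ≈⟨ solve 5 (λ e f v w z → e :* (f :* v :* (w :* z)) := (e :* v :* w) :* (f :* z))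
               refl (pow R (- 1#) b) (ι (b ℕ.!)) (pow R (- x) b) (pow R y b) (pow R y s) ⟩
        (pow R (- 1#) b * pow R (- x) b * pow R y b) * (ι (b ℕ.!) * pow R y s)
          ≈⟨ *-congʳ (pow-unit (- 1#) (- x) y b
               (trans (solve 2 (λ x y → con -[1+ 0 ] :* (:- x) :* y := x :* y) refl x y) xy≈1)) ⟩
        1# * (ι (b ℕ.!) * pow R y s)
          ≈⟨ *-identityˡ _ ⟩
        ι (b ℕ.!) * pow R y s ∎

    xBlock-step : ∀ a b s →
      Det (suc a ℕ.+ b) (blockMatrix (suc a) b s)
        ≈ ι (a ℕ.!) * pow R (y - x) b * pow R x (b ℕ.+ s) * Det (a ℕ.+ b) (blockMatrix a b (suc s))
    xBlock-step a b s = begin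
      Det (suc a ℕ.+ b) (blockMatrix (suc a) b s)
        ≈⟨ seqMatrix-reduction (a ℕ.+ b) cols νs s order j₀ others-vanish ⟩
      sign j₀ * Δ* νs (cols j₀) s * minor
        ≡⟨ P.cong₂ (λ n κ → pow R (- 1#) n * Δ* νs (column κ) s * minor) sign-j₀ kind-j₀ ⟩
      pow R (- 1#) a * Δ* νs (polyExp x a) s * minor
        ≈⟨ *-cong leading-entry (Det-cong (a ℕ.+ b) (λ i k →
             reflexive (P.cong (λ κ → column κ (suc s ℕ.+ toℕ i)) (columnKind-punchIn a b k)))) ⟩
      ι (a ℕ.!) * pow R (y - x) b * pow R x (b ℕ.+ s) * Det (a ℕ.+ b) (blockMatrix a b (suc s)) ∎
      where
      cols : Fin (suc a ℕ.+ b) → Seq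
      cols = column ∘ columnKind (suc a)
      νs : List Carrier
      νs = replicate b x ++ replicate a y
      order : length νs ℕ.< suc (a ℕ.+ b)
      order = order-≤ νs (a ℕ.+ b) (P.trans (ListP.length-++ (replicate b x))
        (P.trans (P.cong₂ ℕ._+_ (ListP.length-replicate b) (ListP.length-replicate a)) (ℕP.+-comm b a)))
      j₀ : Fin (suc a ℕ.+ b)
      j₀ = Fin.fromℕ a ↑ˡ b
      sign-j₀ : toℕ j₀ ≡ a
      sign-j₀ = P.trans (FinP.toℕ-↑ˡ (Fin.fromℕ a) b) (FinP.toℕ-fromℕ a)
      kind-j₀ : columnKind (suc a) j₀ ≡ inj₁ a
      kind-j₀ = P.trans (P.cong (Sum.map toℕ toℕ) (FinP.splitAt-↑ˡ (suc a) (Fin.fromℕ a) b))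
                        (P.cong inj₁ (FinP.toℕ-fromℕ a))
      minor : Carrier
      minor = Det (a ℕ.+ b) (seqMatrix (cols ∘ punchIn j₀) (suc s))

      x-column-vanishes : ∀ c → c ℕ.< a → Δ* νs (polyExp x c) s ≈ 0#
      x-column-vanishes c c<a = trans (Δ*-++ (replicate b x) (replicate a y) (polyExp x c) s)
        (Δ*-zero (replicate b x) (Δ^-annihilates y x yx≈1 c a c<a) s)
      y-column-vanishes : ∀ d → d ℕ.< b → Δ* νs (polyExp y d) s ≈ 0#
      y-column-vanishes d d<b = trans (Δ*-++ (replicate b x) (replicate a y) (polyExp y d) s)
        (trans (Δ*-comm (replicate b x) (replicate a y) (polyExp y d) s)
               (Δ*-zero (replicate a y) (Δ^-annihilates x y xy≈1 d b d<b) s))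
      others-vanish : ∀ j → j ≢ j₀ → Δ* νs (cols j) s ≈ 0#
      others-vanish j j≢j₀ with splitAt (suc a) j in split≡
      ... | inj₁ c = x-column-vanishes (toℕ c) (toℕ<-≢last c (λ c≡last →
              j≢j₀ (P.trans (P.sym (FinP.splitAt⁻¹-↑ˡ split≡)) (P.cong (_↑ˡ b) c≡last))))
      ... | inj₂ d = y-column-vanishes (toℕ d) (FinP.toℕ<n d)

      -- Δ y ^ a turns t^a x^t into a geometric sequence of ratio x
      geometric : Seq
      geometric t = ι (a ℕ.!) * pow R (- y) a * pow R x (a ℕ.+ t)
      geometric-ratio : ∀ t → geometric (suc t) ≈ x * geometric t
      geometric-ratio t = trans (reflexive (P.cong (λ n → ι (a ℕ.!) * pow R (- y) a * pow R x n) (ℕP.+-suc a t)))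
        (solve 3 (λ f q z → f :* (z :* q) := z :* (f :* q)) refl (ι (a ℕ.!) * pow R (- y) a) (pow R x (a ℕ.+ t)) x)

      leading-entry : pow R (- 1#) a * Δ* νs (polyExp x a) s ≈ ι (a ℕ.!) * pow R (y - x) b * pow R x (b ℕ.+ s)
      leading-entry = begin
        pow R (- 1#) a * Δ* νs (polyExp x a) s
          ≈⟨ *-congˡ (Δ*-++ (replicate b x) (replicate a y) (polyExp x a) s) ⟩
        pow R (- 1#) a * Δ^ x b (Δ^ y a (polyExp x a)) s
          ≈⟨ *-congˡ (Δ*-cong (replicate b x) (Δ^-diagonal y x yx≈1 a) s) ⟩
        pow R (- 1#) a * Δ^ x b geometric s
          ≈⟨ *-congˡ (Δ^-geometric x x geometric geometric-ratio b s) ⟩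
        pow R (- 1#) a * (pow R (1# - x * x) b * geometric s)
          ≈⟨ *-congˡ (*-cong (trans (pow-cong b one-minus-x²) (pow-* x (y - x) b))
                             (*-congˡ (pow-+ x a s))) ⟩
        pow R (- 1#) a * ((pow R x b * pow R (y - x) b) * (ι (a ℕ.!) * pow R (- y) a * (pow R x a * pow R x s)))
          ≈⟨ solve 7 (λ e w q f v u z → e :* ((w :* q) :* (f :* v :* (u :* z))) := (e :* v :* u) :* (f :* q :* (w :* z)))
               refl (pow R (- 1#) a) (pow R x b) (pow R (y - x) b) (ι (a ℕ.!)) (pow R (- y) a) (pow R x a) (pow R x s) ⟩
        (pow R (- 1#) a * pow R (- y) a * pow R x a) * (ι (a ℕ.!) * pow R (y - x) b * (pow R x b * pow R x s))
          ≈⟨ *-cong (pow-unit (- 1#) (- y) x a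
                      (trans (solve 2 (λ y x → con -[1+ 0 ] :* (:- y) :* x := x :* y) refl y x) xy≈1))
                    (*-congˡ (sym (pow-+ x b s))) ⟩
        1# * (ι (a ℕ.!) * pow R (y - x) b * pow R x (b ℕ.+ s))
          ≈⟨ *-identityˡ _ ⟩
        ι (a ℕ.!) * pow R (y - x) b * pow R x (b ℕ.+ s) ∎
        where
        one-minus-x² : 1# - x * x ≈ x * (y - x)
        one-minus-x² = trans (+-congʳ (sym xy≈1)) (solve 2 (λ x y → x :* y :- x :* x := x :* (y :- x)) refl x y)

    yPowers : ℕ → ℕ → Carrier
    yPowers zero    s = 1#
    yPowers (suc b) s = pow R y s * yPowers b (suc s)

    xPowers : ℕ → ℕ → ℕ → Carrier
    xPowers zero    b s = 1#
    xPowers (suc a) b s = pow R x (b ℕ.+ s) * xPowers a b (suc s)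

    yBlock-det : ∀ b s → Det b (blockMatrix 0 b s) ≈ ι (G1 b) * yPowers b s
    yBlock-det zero    s = sym (trans (*-identityʳ _) (+-identityʳ _))
    yBlock-det (suc b) s = begin
      Det (suc b) (blockMatrix 0 (suc b) s)
        ≈⟨ yBlock-step b s ⟩
      ι (b ℕ.!) * pow R y s * Det b (blockMatrix 0 b (suc s))
        ≈⟨ *-congˡ (yBlock-det b (suc s)) ⟩
      ι (b ℕ.!) * pow R y s * (ι (G1 b) * yPowers b (suc s))
        ≈⟨ solve 4 (λ f p g q → f :* p :* (g :* q) := (g :* f) :* (p :* q))
             refl (ι (b ℕ.!)) (pow R y s) (ι (G1 b)) (yPowers b (suc s)) ⟩
      (ι (G1 b) * ι (b ℕ.!)) * yPowers (suc b) s
        ≈⟨ *-congʳ (sym (ι-* (G1 b) (b ℕ.!))) ⟩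
      ι (G1 (suc b)) * yPowers (suc b) s ∎

    blockMatrix-det : ∀ a b s →
      Det (a ℕ.+ b) (blockMatrix a b s)
        ≈ ι (G1 a) * pow R (y - x) (a ℕ.* b) * xPowers a b s * Det b (blockMatrix 0 b (s ℕ.+ a))
    blockMatrix-det zero b s = begin
      Det b (blockMatrix 0 b s)
        ≡⟨ P.cong (Det b ∘ blockMatrix 0 b) (P.sym (ℕP.+-identityʳ s)) ⟩
      Det b (blockMatrix 0 b (s ℕ.+ 0))
        ≈⟨ solve 1 (λ d → d := (con (+ 1) :+ con (+ 0)) :* con (+ 1) :* con (+ 1) :* d) refl _ ⟩
      ι (G1 0) * pow R (y - x) 0 * xPowers 0 b s * Det b (blockMatrix 0 b (s ℕ.+ 0)) ∎
    blockMatrix-det (suc a) b s = begin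
      Det (suc a ℕ.+ b) (blockMatrix (suc a) b s)
        ≈⟨ xBlock-step a b s ⟩
      ι (a ℕ.!) * pow R (y - x) b * pow R x (b ℕ.+ s) * Det (a ℕ.+ b) (blockMatrix a b (suc s))
        ≈⟨ *-congˡ (blockMatrix-det a b (suc s)) ⟩
      ι (a ℕ.!) * pow R (y - x) b * pow R x (b ℕ.+ s) * (ι (G1 a) * pow R (y - x) (a ℕ.* b) * xPowers a b (suc s) * D)
        ≈⟨ solve 7 (λ f q w g q′ p d → f :* q :* w :* (g :* q′ :* p :* d) := (g :* f) :* (q :* q′) :* (w :* p) :* d)
             refl (ι (a ℕ.!)) (pow R (y - x) b) (pow R x (b ℕ.+ s))
                  (ι (G1 a)) (pow R (y - x) (a ℕ.* b)) (xPowers a b (suc s)) D ⟩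
      (ι (G1 a) * ι (a ℕ.!)) * (pow R (y - x) b * pow R (y - x) (a ℕ.* b)) * xPowers (suc a) b s * D
        ≈⟨ *-congʳ (*-congʳ (*-cong (sym (ι-* (G1 a) (a ℕ.!))) (sym (pow-+ (y - x) b (a ℕ.* b))))) ⟩
      ι (G1 (suc a)) * pow R (y - x) (suc a ℕ.* b) * xPowers (suc a) b s * D
        ≡⟨ P.cong (λ t → ι (G1 (suc a)) * pow R (y - x) (suc a ℕ.* b) * xPowers (suc a) b s * Det b (blockMatrix 0 b t))
                  (P.sym (ℕP.+-suc s a)) ⟩
      ι (G1 (suc a)) * pow R (y - x) (suc a ℕ.* b) * xPowers (suc a) b s * Det b (blockMatrix 0 b (s ℕ.+ suc a)) ∎
      where
      D : Carrier
      D = Det b (blockMatrix 0 b (suc s ℕ.+ a))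

    powers-cancel : ∀ a b s → xPowers a b s * yPowers a (b ℕ.+ s) ≈ 1#
    powers-cancel zero    b s = *-identityˡ _
    powers-cancel (suc a) b s = begin
      (pow R x (b ℕ.+ s) * xPowers a b (suc s)) * (pow R y (b ℕ.+ s) * yPowers a (suc (b ℕ.+ s)))
        ≈⟨ interchange _ _ _ _ ⟩
      (pow R x (b ℕ.+ s) * pow R y (b ℕ.+ s)) * (xPowers a b (suc s) * yPowers a (suc (b ℕ.+ s)))
        ≈⟨ *-cong (trans (sym (pow-* x y (b ℕ.+ s))) (trans (pow-cong (b ℕ.+ s) xy≈1) (pow-1 (b ℕ.+ s))))
                  (trans (reflexive (P.cong (λ t → xPowers a b (suc s) * yPowers a t) (P.sym (ℕP.+-suc b s))))
                         (powers-cancel a b (suc s))) ⟩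
      1# * 1# ≈⟨ *-identityˡ _ ⟩
      1# ∎
      where open import Algebra.Properties.CommutativeSemigroup *-commutativeSemigroup using (interchange)

    blockMatrix-square-det : ∀ m → Det (m ℕ.+ m) (blockMatrix m m 0) ≈ pow R (ι (G1 m)) 2 * pow R (y - x) (m ℕ.* m)
    blockMatrix-square-det m = begin
      Det (m ℕ.+ m) (blockMatrix m m 0)
        ≈⟨ blockMatrix-det m m 0 ⟩
      ι (G1 m) * pow R (y - x) (m ℕ.* m) * xPowers m m 0 * Det m (blockMatrix 0 m m)
        ≈⟨ *-congˡ (yBlock-det m m) ⟩
      ι (G1 m) * pow R (y - x) (m ℕ.* m) * xPowers m m 0 * (ι (G1 m) * yPowers m m)
        ≈⟨ solve 4 (λ g q p r → g :* q :* p :* (g :* r) := g :* (g :* con (+ 1)) :* q :* (p :* r))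
             refl (ι (G1 m)) (pow R (y - x) (m ℕ.* m)) (xPowers m m 0) (yPowers m m) ⟩
      pow R (ι (G1 m)) 2 * pow R (y - x) (m ℕ.* m) * (xPowers m m 0 * yPowers m m)
        ≈⟨ *-congˡ (trans (reflexive (P.cong (λ t → xPowers m m 0 * yPowers m t) (P.sym (ℕP.+-identityʳ m))))
                          (powers-cancel m m 0)) ⟩
      pow R (ι (G1 m)) 2 * pow R (y - x) (m ℕ.* m) * 1#
        ≈⟨ *-identityʳ _ ⟩
      pow R (ι (G1 m)) 2 * pow R (y - x) (m ℕ.* m) ∎

    matA≈blockMatrix : ∀ m (k j : Fin (m ℕ.+ m)) → matA R m x y k j ≈ blockMatrix m m 0 k j
    matA≈blockMatrix m k j with splitAt m j
    ... | inj₁ c = refl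
    ... | inj₂ d = refl

open import Data.Nat using (_≤_; _+_; _*_)

corollary2 : ∀ {c ℓ} (R : CommutativeRing c ℓ) (m : ℕ) → 1 ≤ m →
    (x xinv : CommutativeRing.Carrier R) →
    CommutativeRing._≈_ R (CommutativeRing._*_ R x xinv) (CommutativeRing.1# R) →
    CommutativeRing._≈_ R (det R (m + m) (matA R m x xinv))
    (CommutativeRing._*_ R (pow R (fromℕ R (G1 m)) 2)
    (pow R (CommutativeRing._-_ R xinv x) (m * m)))
corollary2 R m _ x xinv x·xinv≈1 = begin
  det R (m + m) (matA R m x xinv)                 ≈⟨ Det-cong (m + m) (matA≈blockMatrix x xinv x·xinv≈1 m) ⟩
  Det (m + m) (blockMatrix x xinv x·xinv≈1 m m 0)  ≈⟨ blockMatrix-square-det x xinv x·xinv≈1 m ⟩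
  pow R (fromℕ R (G1 m)) 2 · pow R (xinv - x) (m * m) ∎
  where
  open CommutativeRing R using (_-_; setoid) renaming (_*_ to _·_)
  open import Relation.Binary.Reasoning.Setoid setoid
  open Determinant R
  open ConfluentBlocks R
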